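{- There are infinitely many graphs $G$ such that $\overline{\operatorname{Z}}(G)=\operatorname{Z}(G)$ and $\overline{\operatorname{Z}}(G\vee K_1)>\operatorname{Z}(G\vee K_1)$.
   Context: All graphs are finite, simple and undirected. $G\vee K_1$ denotes the graph obtained from $G$ by adding one new vertex adjacent to every vertex of $G$ (a universal vertex). Given a set $S$ of initially blue vertices (all others white), the zero forcing color change rule says that a blue vertex with exactly one white neighbor causes that neighbor to become blue. $S$ is a zero forcing set if repeatedly applying this rule eventually makes every vertex blue. $\operatorname{Z}(G)$ is the minimum cardinality of a zero forcing set of $G$. A minimal zero forcing set is a zero forcing set containing no other zero forcing set as a proper subset, and $\overline{\operatorname{Z}}(G)$ is the maximum size of a minimal zero forcing set of $G$. -}

module Defs where

open import Data.Nat using (ℕ; suc; _≤_; _<_)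
open import Data.Bool using (Bool; true; false)
open import Data.Fin using (Fin; zero; suc)
open import Data.Fin.Subset using (Subset; _∈_; _⊆_; ∣_∣)
open import Data.Product using (Σ; _×_; _,_; ∃)
open import Relation.Binary.PropositionalEquality using (_≡_)
open import Relation.Nullary using (¬_)

record Graph (n : ℕ) : Set where
  field
    adj     : Fin n → Fin n → Bool
    adj-sym : ∀ i j → adj i j ≡ adj j i
    irrefl  : ∀ i → adj i i ≡ false
open Graph public

joinAdj : ∀ {n} → Graph n → Fin (suc n) → Fin (suc n) → Bool
joinAdj G zero    zero    = false
joinAdj G zero    (suc j) = true
joinAdj G (suc i) zero    = true
joinAdj G (suc i) (suc j) = adj G i j

joinSym : ∀ {n} (G : Graph n) i j → joinAdj G i j ≡ joinAdj G j i
joinSym G zero    zero    = _≡_.refl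
joinSym G zero    (suc j) = _≡_.refl
joinSym G (suc i) zero    = _≡_.refl
joinSym G (suc i) (suc j) = adj-sym G i j

joinIrr : ∀ {n} (G : Graph n) i → joinAdj G i i ≡ false
joinIrr G zero    = _≡_.refl
joinIrr G (suc i) = irrefl G i

_∨K₁ : ∀ {n} → Graph n → Graph (suc n)
G ∨K₁ = record { adj = joinAdj G ; adj-sym = joinSym G ; irrefl = joinIrr G }

-- Vertices that end up blue starting from the blue set S, under the
-- zero forcing color change rule: a blue vertex u all of whose neighbours
-- other than v are blue forces its (only possibly white) neighbour v.
-- (The final coloring is the least set containing S closed under this rule.)
data Blue {n} (G : Graph n) (S : Subset n) : Fin n → Set where
  initial : ∀ {v} → v ∈ S → Blue G S v
  force   : ∀ {u v} → Blue G S u → adj G u v ≡ true →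
            (∀ w → adj G u w ≡ true → ¬ (w ≡ v) → Blue G S w) →
            Blue G S v

IsZFS : ∀ {n} → Graph n → Subset n → Set
IsZFS G S = ∀ v → Blue G S v

IsMinimalZFS : ∀ {n} → Graph n → Subset n → Set
IsMinimalZFS G S = IsZFS G S × (∀ T → T ⊆ S → IsZFS G T → T ≡ S)

IsZ : ∀ {n} → Graph n → ℕ → Set
IsZ G k = (Σ _ λ S → IsZFS G S × ∣ S ∣ ≡ k) × (∀ S → IsZFS G S → k ≤ ∣ S ∣)

IsZbar : ∀ {n} → Graph n → ℕ → Set
IsZbar G k = (Σ _ λ S → IsMinimalZFS G S × ∣ S ∣ ≡ k) × (∀ S → IsMinimalZFS G S → ∣ S ∣ ≤ k)

-- G is the 4-cycle A C B D with p ≥ 2 pendant vertices P i attached at A.  A fort is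
-- a nonempty set F of vertices such that no vertex outside F has exactly one neighbour
-- in F; if S misses F then no vertex of F ever turns blue, so every zero forcing set
-- meets every fort.  Twins such as C, D or P i, P j form forts, so a zero forcing set
-- of G contains C or D and all pendants but one, and conversely these p vertices
-- force G.  Hence every zero forcing set contains one of size p: Z(G) = Z̄(G) = p.
-- In G ∨ K₁ the apex together with a dominating set of G is a fort.  As {A, B}, {A, C}
-- and {A, D} dominate G, a zero forcing set of G ∨ K₁ moreover contains the apex, or A,
-- or all of B, C, D, so it contains a zero forcing set of size p + 1 or p + 2.  Thus
-- Z(G ∨ K₁) = p + 1, while {B, C, D} with all pendants but one is a minimal zero
-- forcing set of size p + 2.
module Submission where

open import Defs
open import Data.Nat using (ℕ; zero; suc; _+_; _∸_; _≤_; _<_)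
open import Data.Nat.Properties using (≤-refl; ≤-trans; n≤1+n; m≤n+m)
open import Data.Bool using (Bool; true; false; _∨_)
open import Data.Bool.Properties using (∨-comm)
open import Data.Fin using (Fin; zero; suc; _≟_; punchIn)
open import Data.Fin.Properties using (suc-injective; punchInᵢ≢i; all?; ¬∀⟶∃¬)
open import Data.Fin.Subset using (Subset; _∈_; _∉_; _⊆_; ∣_∣; ∁; ⁅_⁆)
open import Data.Fin.Subset.Properties
  using (_∈?_; drop-there; s⊆s; out⊆; ⊆-antisym; p⊆q⇒∣p∣≤∣q∣; x∈∁p⇒x∉p; x∉p⇒x∈∁p; x∈⁅x⁆; x≢y⇒x∉⁅y⁆; ∣∁p∣≡n∸∣p∣; ∣⁅x⁆∣≡1)
open import Data.Vec using (_∷_; here; there)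
open import Data.List using (List; []; _∷_; map)
open import Data.List.Relation.Unary.Any using (Any; here; there; any?)
import Data.List.Membership.Propositional as List
open import Data.List.Membership.Propositional.Properties using (∈-map⁺)
open import Data.Product using (Σ; ∃-syntax; _×_; _,_; proj₁)
open import Data.Sum using (_⊎_; inj₁; inj₂; [_,_]′) renaming (map to ⊎-map)
open import Data.Empty using (⊥-elim)
open import Function using (_∘_; id; _∋_)
open import Relation.Nullary using (¬_; yes; no)
open import Relation.Unary using (Decidable)
open import Relation.Binary.PropositionalEquality using (_≡_; _≢_; refl; sym; trans; cong; cong₂; subst)

private
  variable
    n : ℕ
    Γ : Graph n
    S : Subset n
    v x y : Fin n

symmetrise : (e : Fin n → Fin n → Bool) → (∀ i → e i i ≡ false) → Graph n
symmetrise e loopless = record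
  { adj     = λ i j → e i j ∨ e j i
  ; adj-sym = λ i j → ∨-comm (e i j) (e j i)
  ; irrefl  = λ i → cong₂ _∨_ (loopless i) (loopless i)
  }

IsFort : Graph n → List (Fin n) → Set
IsFort Γ F = ∀ {u v} → u List.∉ F → adj Γ u v ≡ true → v List.∈ F →
  ∃[ w ] adj Γ u w ≡ true × w ≢ v × w List.∈ F

blue-∉-fort : ∀ {F} → IsFort Γ F → (∀ {w} → w List.∈ F → w ∉ S) → Blue Γ S v → v List.∉ F
blue-∉-fort fort disjoint (initial v∈S) v∈F = disjoint v∈F v∈S
blue-∉-fort fort disjoint (force blue-u uv others) v∈F =
  let (w , uw , w≢v , w∈F) = fort (blue-∉-fort fort disjoint blue-u) uv v∈F
  in  blue-∉-fort fort disjoint (others _ uw w≢v) w∈F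

zfs-meets-fort : ∀ {F} → IsFort Γ F → IsZFS Γ S → v List.∈ F → Any (_∈ S) F
zfs-meets-fort {S = S} {F = F} fort zfs v∈F with any? (_∈? S) F
... | yes meets = meets
... | no ¬meets = ⊥-elim (blue-∉-fort fort (λ w∈F w∈S → ¬meets (List.lose w∈F w∈S)) (zfs _) v∈F)

Twins : Graph n → Fin n → Fin n → Set
Twins Γ x y = ∀ u → adj Γ u x ≡ adj Γ u y

twins-fort : x ≢ y → Twins Γ x y → IsFort Γ (x ∷ y ∷ [])
twins-fort x≢y twins {u} _ ux (here refl) = _ , trans (sym (twins u)) ux , x≢y ∘ sym , there (here refl)
twins-fort x≢y twins {u} _ uy (there (here refl)) = _ , trans (twins u) uy , x≢y , here refl

zfs-meets-twins : x ≢ y → Twins Γ x y → IsZFS Γ S → x ∈ S ⊎ y ∈ S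
zfs-meets-twins {Γ = Γ} x≢y twins zfs with zfs-meets-fort (twins-fort {Γ = Γ} x≢y twins) zfs (here refl)
... | here x∈S = inj₁ x∈S
... | there (here y∈S) = inj₂ y∈S

Dominating : Graph n → List (Fin n) → Set
Dominating Γ D = ∀ v → v List.∈ D ⊎ Any (λ d → adj Γ v d ≡ true) D

-- Every vertex outside the fort sees both the apex and some vertex of D.
apex-dominating-fort : ∀ {D} → Dominating Γ D → IsFort (Γ ∨K₁) (zero ∷ map suc D)
apex-dominating-fort dom {zero} zero∉F _ _ = ⊥-elim (zero∉F (here refl))
apex-dominating-fort dom {suc u} {v} u∉F _ _ with dom u
... | inj₁ u∈D = ⊥-elim (u∉F (there (∈-map⁺ suc u∈D)))
... | inj₂ sees-D with List.find sees-D | v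
...   | d , d∈D , ud | zero  = suc d , ud , (λ ()) , there (∈-map⁺ suc d∈D)
...   | _ , _ , _    | suc _ = zero , refl , (λ ()) , here refl

join-twins : Twins Γ x y → Twins (Γ ∨K₁) (suc x) (suc y)
join-twins twins zero    = refl
join-twins twins (suc u) = twins u

blue-join : ∀ {b} → Blue Γ S v → Blue (Γ ∨K₁) (b ∷ S) zero → Blue (Γ ∨K₁) (b ∷ S) (suc v)
blue-join (initial v∈S) _ = initial (there v∈S)
blue-join (force blue-u uv others) blue-apex = force (blue-join blue-u blue-apex) uv λ where
  zero    _  _   → blue-apex
  (suc w) uw w≢v → blue-join (others w uw (w≢v ∘ cong suc)) blue-apex

join-zfs : ∀ {b} → IsZFS Γ S → Blue (Γ ∨K₁) (b ∷ S) zero → IsZFS (Γ ∨K₁) (b ∷ S)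
join-zfs zfs blue-apex zero    = blue-apex
join-zfs zfs blue-apex (suc v) = blue-join (zfs v) blue-apex

ShrinksWithin : Graph n → ℕ → ℕ → Set
ShrinksWithin {n} Γ lo hi = ∀ S → IsZFS Γ S →
  ∃[ T ] T ⊆ S × IsZFS Γ T × lo ≤ ∣ T ∣ × ∣ T ∣ ≤ hi

isZ-intro : ∀ {lo hi} → IsZFS Γ S → ∣ S ∣ ≡ lo → ShrinksWithin Γ lo hi → IsZ Γ lo
isZ-intro zfs size shrink = (_ , zfs , size) , λ S zfsS →
  let (_ , T⊆S , _ , lo≤T , _) = shrink S zfsS in ≤-trans lo≤T (p⊆q⇒∣p∣≤∣q∣ T⊆S)

isZbar-intro : ∀ {lo hi} → IsMinimalZFS Γ S → ∣ S ∣ ≡ hi → ShrinksWithin Γ lo hi → IsZbar Γ hi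
isZbar-intro {hi = hi} minimal size shrink = (_ , minimal , size) , λ S (zfsS , minimalS) →
  let (T , T⊆S , zfsT , _ , T≤hi) = shrink S zfsS
  in  subst (λ X → ∣ X ∣ ≤ hi) (minimalS T T⊆S zfsT) T≤hi

≡⇒within : ∀ {k k′ lo hi} → lo ≤ k′ → k′ ≤ hi → k ≡ k′ → lo ≤ k × k ≤ hi
≡⇒within lo≤k′ k′≤hi refl = lo≤k′ , k′≤hi

minimal-intro : IsZFS Γ S → (∀ T → T ⊆ S → IsZFS Γ T → S ⊆ T) → IsMinimalZFS Γ S
minimal-intro zfs contained = zfs , λ T T⊆S zfsT → ⊆-antisym T⊆S (contained T T⊆S zfsT)

pairwise⇒all-but : ∀ {k} {Q : Fin k → Set} {i j} →
  (∀ {i j} → i ≢ j → Q i ⊎ Q j) → ¬ Q j → i ≢ j → Q i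
pairwise⇒all-but pairwise ¬Qj i≢j = [ id , ⊥-elim ∘ ¬Qj ]′ (pairwise i≢j)

pairwise⇒all-but-one : ∀ {k} {Q : Fin (suc k) → Set} → Decidable Q →
  (∀ {i j} → i ≢ j → Q i ⊎ Q j) → ∃[ j ] (∀ {i} → i ≢ j → Q i)
pairwise⇒all-but-one Q? pairwise with all? Q?
... | yes all = zero , λ _ → all _
... | no ¬all = let (j , ¬Qj) = ¬∀⟶∃¬ _ _ Q? ¬all in j , pairwise⇒all-but pairwise ¬Qj

pattern A   = zero
pattern B   = suc zero
pattern C   = suc (suc zero)
pattern D   = suc (suc (suc zero))
pattern P i = suc (suc (suc (suc i)))

module CycleWithPendants (m : ℕ) where

  p : ℕ
  p = suc (suc m)

  edge : Fin (4 + p) → Fin (4 + p) → Bool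
  edge A C     = true
  edge A D     = true
  edge A (P _) = true
  edge B C     = true
  edge B D     = true
  edge _ _     = false

  loopless : ∀ i → edge i i ≡ false
  loopless A     = refl
  loopless B     = refl
  loopless C     = refl
  loopless D     = refl
  loopless (P _) = refl

  G : Graph (4 + p)
  G = symmetrise edge loopless

  H : Graph (5 + p)
  H = G ∨K₁

  C-D-twins : Twins G C D
  C-D-twins A     = refl
  C-D-twins B     = refl
  C-D-twins C     = refl
  C-D-twins D     = refl
  C-D-twins (P _) = refl

  pendant-twins : ∀ {i j} → Twins G (P i) (P j)
  pendant-twins A     = refl
  pendant-twins B     = refl
  pendant-twins C     = refl
  pendant-twins D     = refl
  pendant-twins (P _) = refl

  P-injective : ∀ {i j : Fin p} → P i ≡ (Fin (4 + p) ∋ P j) → i ≡ j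
  P-injective refl = refl

  A-dominates-with : ∀ {x} → x ≡ B ⊎ adj G B x ≡ true → Dominating G (A ∷ x ∷ [])
  A-dominates-with _           A     = inj₁ (here refl)
  A-dominates-with (inj₁ refl) B     = inj₁ (there (here refl))
  A-dominates-with (inj₂ Bx)   B     = inj₂ (there (here Bx))
  A-dominates-with _           C     = inj₂ (here refl)
  A-dominates-with _           D     = inj₂ (here refl)
  A-dominates-with _           (P _) = inj₂ (here refl)

  AllPendantsBut : Fin p → Subset (4 + p) → Set
  AllPendantsBut j S = ∀ {i} → i ≢ j → P i ∈ S

  another-pendant : (j : Fin p) → punchIn j zero ≢ j
  another-pendant j = punchInᵢ≢i j zero

  select : Bool → Bool → Bool → Bool → Fin p → Subset (4 + p)
  select a b c d j = a ∷ b ∷ c ∷ d ∷ ∁ ⁅ j ⁆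

  select-pendants : ∀ {a b c d} j → AllPendantsBut j (select a b c d j)
  select-pendants _ i≢j = there (there (there (there (x∉p⇒x∈∁p (x≢y⇒x∉⁅y⁆ i≢j)))))

  select-∌ : ∀ {a b c d} j → P j ∉ select a b c d j
  select-∌ j (there (there (there (there j∈∁)))) = x∈∁p⇒x∉p j∈∁ (x∈⁅x⁆ j)

  select-⊆ : ∀ {a b c d j} {S : Subset (4 + p)} →
    (a ≡ true → A ∈ S) → (b ≡ true → B ∈ S) → (c ≡ true → C ∈ S) → (d ≡ true → D ∈ S) →
    AllPendantsBut j S → select a b c d j ⊆ S
  select-⊆ hA _  _  _  _ here = hA refl
  select-⊆ _  hB _  _  _ (there here) = hB refl
  select-⊆ _  _  hC _  _ (there (there here)) = hC refl
  select-⊆ _  _  _  hD _ (there (there (there here))) = hD refl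
  select-⊆ _  _  _  _  pendants (there (there (there (there i∈∁)))) =
    pendants λ { refl → x∈∁p⇒x∉p i∈∁ (x∈⁅x⁆ _) }

  -- For concrete flags, ∣ select a b c d j ∣ reduces to (number of flags set) + ∣ ∁ ⁅ j ⁆ ∣.
  ∣select∣ : ∀ k (j : Fin p) → k + ∣ ∁ ⁅ j ⁆ ∣ ≡ k + suc m
  ∣select∣ k j = cong (k +_) (trans (∣∁p∣≡n∸∣p∣ ⁅ j ⁆) (cong (p ∸_) (∣⁅x⁆∣≡1 j)))

  zfs⇒C-or-D : ∀ {S} → IsZFS G S → C ∈ S ⊎ D ∈ S
  zfs⇒C-or-D = zfs-meets-twins (λ ()) C-D-twins

  zfs⇒pendant-pairs : ∀ {S} → IsZFS G S → ∀ {i j} → i ≢ j → P i ∈ S ⊎ P j ∈ S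
  zfs⇒pendant-pairs zfs i≢j = zfs-meets-twins (i≢j ∘ P-injective) pendant-twins zfs

  zfs⇐ : ∀ {S j} → AllPendantsBut j S → C ∈ S ⊎ D ∈ S → IsZFS G S
  zfs⇐ {S} {j} pendants C-or-D = all-blue (blue-BCD C-or-D)
    where
    blue-A : Blue G S A
    blue-A = force (initial (pendants (another-pendant j))) refl λ where
      A     _  A≢A → ⊥-elim (A≢A refl)
      B     () _
      C     () _
      D     () _
      (P _) () _

    blue-BCD : C ∈ S ⊎ D ∈ S → Blue G S B × Blue G S C × Blue G S D
    blue-BCD (inj₁ C∈S) = b , c , force b refl λ where
        A     () _
        B     () _
        C     _  _   → c
        D     _  D≢D → ⊥-elim (D≢D refl)
        (P _) () _
      where
      c = initial C∈S
      b = force c refl λ where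
        A     _  _   → blue-A
        B     _  B≢B → ⊥-elim (B≢B refl)
        C     () _
        D     () _
        (P _) () _
    blue-BCD (inj₂ D∈S) = b , force b refl (λ where
        A     () _
        B     () _
        C     _  C≢C → ⊥-elim (C≢C refl)
        D     _  _   → d
        (P _) () _) , d
      where
      d = initial D∈S
      b = force d refl λ where
        A     _  _   → blue-A
        B     _  B≢B → ⊥-elim (B≢B refl)
        C     () _
        D     () _
        (P _) () _

    all-blue : Blue G S B × Blue G S C × Blue G S D → IsZFS G S
    all-blue _           A = blue-A
    all-blue (b , _ , _) B = b
    all-blue (_ , c , _) C = c
    all-blue (_ , _ , d) D = d
    all-blue (_ , c , d) (P i) with i ≟ j
    ... | no i≢j = initial (pendants i≢j)
    ... | yes refl = force blue-A refl λ where
      A     () _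
      B     () _
      C     _  _   → c
      D     _  _   → d
      (P k) _  k≢j → initial (pendants (k≢j ∘ cong P))

  -- Subsets of H = G ∨ K₁ are written s ∷ S, with s the apex flag and S ⊆ V(G).

  join-zfs⇒C-or-D : ∀ {s S} → IsZFS H (s ∷ S) → C ∈ S ⊎ D ∈ S
  join-zfs⇒C-or-D zfs = ⊎-map drop-there drop-there (zfs-meets-twins (λ ()) (join-twins C-D-twins) zfs)

  join-zfs⇒pendant-pairs : ∀ {s S} → IsZFS H (s ∷ S) → ∀ {i j} → i ≢ j → P i ∈ S ⊎ P j ∈ S
  join-zfs⇒pendant-pairs zfs i≢j = ⊎-map drop-there drop-there
    (zfs-meets-twins (i≢j ∘ P-injective ∘ suc-injective) (join-twins pendant-twins) zfs)

  join-zfs⇒apex-A-or-BCD : ∀ {s S} → IsZFS H (s ∷ S) → s ≡ true ⊎ A ∈ S ⊎ (B ∈ S × C ∈ S × D ∈ S)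
  join-zfs⇒apex-A-or-BCD {true}  zfs = inj₁ refl
  join-zfs⇒apex-A-or-BCD {false} {S} zfs with A ∈? S
  ... | yes A∈S = inj₂ (inj₁ A∈S)
  ... | no  A∉S = inj₂ (inj₂ (forced (inj₁ refl) , forced (inj₂ refl) , forced (inj₂ refl)))
    where
    forced : ∀ {x} → x ≡ B ⊎ adj G B x ≡ true → x ∈ S
    forced {x} dominates
      with zfs-meets-fort (apex-dominating-fort {Γ = G} (A-dominates-with dominates)) zfs (here refl)
    ... | here ()
    ... | there (here A∈S) = ⊥-elim (A∉S (drop-there A∈S))
    ... | there (there (here x∈S)) = drop-there x∈S

  join-zfs⇐ : ∀ {s S j} → AllPendantsBut j S → C ∈ S ⊎ D ∈ S →
    s ≡ true ⊎ A ∈ S ⊎ (B ∈ S × C ∈ S × D ∈ S) → IsZFS H (s ∷ S)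
  join-zfs⇐ {s} {S} {j} pendants C-or-D apex-A-or-BCD =
    join-zfs (zfs⇐ pendants C-or-D) (blue-apex apex-A-or-BCD)
    where
    blue-apex : s ≡ true ⊎ A ∈ S ⊎ (B ∈ S × C ∈ S × D ∈ S) → Blue H (s ∷ S) zero
    blue-apex (inj₁ refl) = initial here
    blue-apex (inj₂ (inj₁ A∈S)) = force (initial (there (pendants (another-pendant j)))) refl λ where
      zero        _  U≢U → ⊥-elim (U≢U refl)
      (suc A)     _  _   → initial (there A∈S)
      (suc B)     () _
      (suc C)     () _
      (suc D)     () _
      (suc (P _)) () _
    blue-apex (inj₂ (inj₂ (B∈S , C∈S , D∈S))) = force (initial (there B∈S)) refl λ where
      zero        _  U≢U → ⊥-elim (U≢U refl)
      (suc A)     () _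
      (suc B)     () _
      (suc C)     _  _   → initial (there C∈S)
      (suc D)     _  _   → initial (there D∈S)
      (suc (P _)) () _

  pendants-but-one : ∀ {S} → (∀ {i j} → i ≢ j → P i ∈ S ⊎ P j ∈ S) → ∃[ j ] AllPendantsBut j S
  pendants-but-one {S} = pairwise⇒all-but-one (λ i → P i ∈? S)

  shrink-G : ShrinksWithin G p p
  shrink-G S zfs with pendants-but-one (zfs⇒pendant-pairs zfs) | zfs⇒C-or-D zfs
  ... | j , pendants | inj₁ C∈S =
    select false false true false j ,
    select-⊆ (λ ()) (λ ()) (λ _ → C∈S) (λ ()) pendants ,
    zfs⇐ (select-pendants j) (inj₁ (there (there here))) ,
    ≡⇒within ≤-refl ≤-refl (∣select∣ 1 j)
  ... | j , pendants | inj₂ D∈S =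
    select false false false true j ,
    select-⊆ (λ ()) (λ ()) (λ ()) (λ _ → D∈S) pendants ,
    zfs⇐ (select-pendants j) (inj₂ (there (there (there here)))) ,
    ≡⇒within ≤-refl ≤-refl (∣select∣ 1 j)

  shrink-H : ShrinksWithin H (suc p) (suc (suc p))
  shrink-H (s ∷ S) zfs
    with pendants-but-one (join-zfs⇒pendant-pairs zfs) | join-zfs⇒C-or-D zfs | join-zfs⇒apex-A-or-BCD zfs
  ... | j , pendants | inj₁ C∈S | inj₁ refl =
    true ∷ select false false true false j ,
    s⊆s (select-⊆ (λ ()) (λ ()) (λ _ → C∈S) (λ ()) pendants) ,
    join-zfs⇐ (select-pendants j) (inj₁ (there (there here))) (inj₁ refl) ,
    ≡⇒within ≤-refl (n≤1+n _) (∣select∣ 2 j)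
  ... | j , pendants | inj₂ D∈S | inj₁ refl =
    true ∷ select false false false true j ,
    s⊆s (select-⊆ (λ ()) (λ ()) (λ ()) (λ _ → D∈S) pendants) ,
    join-zfs⇐ (select-pendants j) (inj₂ (there (there (there here)))) (inj₁ refl) ,
    ≡⇒within ≤-refl (n≤1+n _) (∣select∣ 2 j)
  ... | j , pendants | inj₁ C∈S | inj₂ (inj₁ A∈S) =
    false ∷ select true false true false j ,
    out⊆ (select-⊆ (λ _ → A∈S) (λ ()) (λ _ → C∈S) (λ ()) pendants) ,
    join-zfs⇐ (select-pendants j) (inj₁ (there (there here))) (inj₂ (inj₁ here)) ,
    ≡⇒within ≤-refl (n≤1+n _) (∣select∣ 2 j)
  ... | j , pendants | inj₂ D∈S | inj₂ (inj₁ A∈S) =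
    false ∷ select true false false true j ,
    out⊆ (select-⊆ (λ _ → A∈S) (λ ()) (λ ()) (λ _ → D∈S) pendants) ,
    join-zfs⇐ (select-pendants j) (inj₂ (there (there (there here)))) (inj₂ (inj₁ here)) ,
    ≡⇒within ≤-refl (n≤1+n _) (∣select∣ 2 j)
  ... | j , pendants | _ | inj₂ (inj₂ (B∈S , C∈S , D∈S)) =
    false ∷ select false true true true j ,
    out⊆ (select-⊆ (λ ()) (λ _ → B∈S) (λ _ → C∈S) (λ _ → D∈S) pendants) ,
    join-zfs⇐ (select-pendants j) (inj₁ (there (there here)))
      (inj₂ (inj₂ (there here , there (there here) , there (there (there here))))) ,
    ≡⇒within (n≤1+n _) ≤-refl (∣select∣ 3 j)

  W : Subset (4 + p)
  W = select false false true false zero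

  W-minimal : IsMinimalZFS G W
  W-minimal = minimal-intro (zfs⇐ (select-pendants zero) (inj₁ (there (there here)))) λ T T⊆W zfsT →
    select-⊆ (λ ()) (λ ()) (λ _ → [ id , ⊥-elim ∘ D∉W ∘ T⊆W ]′ (zfs⇒C-or-D zfsT)) (λ ())
      (pairwise⇒all-but (zfs⇒pendant-pairs zfsT) (select-∌ zero ∘ T⊆W))
    where
    D∉W : D ∉ W
    D∉W (there (there (there ())))

  W′ : Subset (5 + p)
  W′ = false ∷ select false true true true zero

  W′-minimal : IsMinimalZFS H W′
  W′-minimal = minimal-intro W′-zfs contains
    where
    W′-zfs : IsZFS H W′
    W′-zfs = join-zfs⇐ (select-pendants zero) (inj₁ (there (there here)))
      (inj₂ (inj₂ (there here , there (there here) , there (there (there here)))))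

    contains : ∀ T → T ⊆ W′ → IsZFS H T → W′ ⊆ T
    contains (t ∷ T) T⊆W′ zfsT with join-zfs⇒apex-A-or-BCD zfsT
    ... | inj₁ refl = ⊥-elim (apex∉W′ (T⊆W′ here))
      where
      apex∉W′ : zero ∉ W′
      apex∉W′ ()
    ... | inj₂ (inj₁ A∈T) = ⊥-elim (A∉W′ (T⊆W′ (there A∈T)))
      where
      A∉W′ : suc A ∉ W′
      A∉W′ (there ())
    ... | inj₂ (inj₂ (B∈T , C∈T , D∈T)) =
      out⊆ (select-⊆ (λ ()) (λ _ → B∈T) (λ _ → C∈T) (λ _ → D∈T)
        (pairwise⇒all-but (join-zfs⇒pendant-pairs zfsT) (select-∌ zero ∘ drop-there ∘ T⊆W′ ∘ there)))

  Z-G : IsZ G p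
  Z-G = isZ-intro (proj₁ W-minimal) (∣select∣ 1 zero) shrink-G

  Zbar-G : IsZbar G p
  Zbar-G = isZbar-intro W-minimal (∣select∣ 1 zero) shrink-G

  Z-H : IsZ H (suc p)
  Z-H = isZ-intro {S = true ∷ W} (join-zfs⇐ (select-pendants zero) (inj₁ (there (there here))) (inj₁ refl)) (∣select∣ 2 zero) shrink-H

  Zbar-H : IsZbar H (suc (suc p))
  Zbar-H = isZbar-intro W′-minimal (∣select∣ 3 zero) shrink-H

theorem3p5 : (N : ℕ) → Σ ℕ λ n → N ≤ n × Σ (Graph n) λ G →
    (Σ ℕ λ k → IsZ G k × IsZbar G k) ×
    (Σ ℕ λ a → Σ ℕ λ b → IsZ (G ∨K₁) a × IsZbar (G ∨K₁) b × a < b)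
theorem3p5 N = 4 + p , m≤n+m N 6 , G , (p , Z-G , Zbar-G) , (suc p , suc (suc p) , Z-H , Zbar-H , ≤-refl)
  where open CycleWithPendants N
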